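{- Let $c=(c_1,\dots,c_k)$ be a composition of $n$, let $\beta_j=c_1+\cdots+c_j$ for $0\le j\le k$, and write the reduced composition polynomial as $f_c(q)=\sum_{i=0}^{n-k}f_iq^i$. Then for each $i$, \[ f_i=\sum_{j:\,\beta_j\le i}\frac{1}{\prod_{l\ne j}(\beta_l-\beta_j)}\binom{k+i-\beta_j-1}{i-\beta_j}, \] where the product runs over $l\in\{0,\dots,k\}\setminus\{j\}$ and $\binom{k+i-\beta_j-1}{i-\beta_j}$ is the number of multisets of size $i-\beta_j$ from a $k$-element set.
   Context: For a composition $c=(c_1,\dots,c_k)$ of $n$ (positive integers summing to $n$), the composition polynomial is \[ g_c(q) := \int_{q}^{1} \int_{q}^{t_k} \cdots \int_{q}^{t_2} t_1^{c_1-1}\cdots t_k^{c_k-1}\, dt_1\cdots dt_k , \] and the reduced composition polynomial is $f_c(q)=g_c(q)/(1-q)^k$, a polynomial of degree $n-k$. -}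

module Defs where

open import Data.Nat as ℕ using (ℕ; zero; suc; _∸_; _≤ᵇ_)
open import Data.Nat.Combinatorics using (_C_)
open import Data.Integer using (+_)
open import Data.Rational as ℚ using (ℚ; 0ℚ; 1ℚ; _+_; _*_; _-_; -_; 1/_; ≢-nonZero)
open import Data.Rational.Properties using (_≟_)
open import Data.List using (List; []; _∷_; foldr; length; take; map; upTo; filter; replicate)
open import Data.Nat.ListAction using (sum)
open import Data.Bool using (Bool; true; false; not)
open import Relation.Nullary using (yes; no)
open import Relation.Nullary.Decidable using (⌊_⌋)

-- Univariate polynomials over ℚ: coefficient lists, lowest degree first.

Poly : Set
Poly = List ℚ

coeff : Poly → ℕ → ℚ
coeff []       _       = 0ℚ
coeff (a ∷ p)  zero    = a
coeff (a ∷ p)  (suc i) = coeff p i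

_⊕_ : Poly → Poly → Poly
[]      ⊕ q       = q
(a ∷ p) ⊕ []      = a ∷ p
(a ∷ p) ⊕ (b ∷ q) = (a + b) ∷ (p ⊕ q)

scale : ℚ → Poly → Poly
scale c = map (c *_)

⊖_ : Poly → Poly
⊖ p = scale (- 1ℚ) p

_⊗_ : Poly → Poly → Poly
[]      ⊗ q = []
(a ∷ p) ⊗ q = scale a q ⊕ (0ℚ ∷ (p ⊗ q))

X : Poly
X = 0ℚ ∷ 1ℚ ∷ []

_^ᵖ_ : Poly → ℕ → Poly
p ^ᵖ zero  = 1ℚ ∷ []
p ^ᵖ suc m = p ⊗ (p ^ᵖ m)

-- Bivariate polynomials in (t, q): list indexed by the power of t,
-- whose entries are polynomials in q.

Poly₂ : Set
Poly₂ = List Poly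

shiftT : ℕ → Poly₂ → Poly₂
shiftT m p = replicate m [] Data.List.++ p
  where import Data.List

antiderivFrom : ℕ → Poly₂ → Poly₂
antiderivFrom e []      = []
antiderivFrom e (a ∷ p) = scale ((+ 1) ℚ./ suc e) a ∷ antiderivFrom (suc e) p

antideriv : Poly₂ → Poly₂
antideriv p = [] ∷ antiderivFrom zero p

evalAtQ : Poly₂ → Poly
evalAtQ []      = []
evalAtQ (a ∷ p) = a ⊕ (X ⊗ evalAtQ p)

evalAt1 : Poly₂ → Poly
evalAt1 []      = []
evalAt1 (a ∷ p) = a ⊕ evalAt1 p

-- definite integral from q to t in the variable t:
-- (∫_q^t p(s,q) ds) = A(t) - A(q) where A is an antiderivative
_⊕₂_ : Poly₂ → Poly₂ → Poly₂
[]      ⊕₂ q       = q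
(a ∷ p) ⊕₂ []      = a ∷ p
(a ∷ p) ⊕₂ (b ∷ q) = (a ⊕ b) ∷ (p ⊕₂ q)

integrateFromQ : Poly₂ → Poly₂
integrateFromQ p = antideriv p ⊕₂ ((⊖ evalAtQ (antideriv p)) ∷ [])

-- Composition polynomial.
-- h₀(t) = 1,  h_j(t) = ∫_q^t h_{j-1}(s) s^{c_j - 1} ds,  g_c(q) = h_k(1).
-- Here 'innerIntegrals' processes c in order c₁, c₂, ... (innermost first).

innerIntegrals : Poly₂ → List ℕ → Poly₂
innerIntegrals h []       = h
innerIntegrals h (c ∷ cs) = innerIntegrals (integrateFromQ (shiftT (c ∸ 1) h)) cs

compPoly : List ℕ → Poly
compPoly c = evalAt1 (innerIntegrals ((1ℚ ∷ []) ∷ []) c)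

-- exact division by (1 - q): if p = (1-q) Q then Q_i = p_0 + ... + p_i;
-- the quotient has one coefficient fewer than p.
divOneMinusQFrom : ℚ → Poly → Poly
divOneMinusQFrom acc []          = []
divOneMinusQFrom acc (a ∷ [])    = []
divOneMinusQFrom acc (a ∷ b ∷ p) = (acc + a) ∷ divOneMinusQFrom (acc + a) (b ∷ p)

divOneMinusQ : Poly → Poly
divOneMinusQ = divOneMinusQFrom 0ℚ

divOneMinusQ^ : ℕ → Poly → Poly
divOneMinusQ^ zero    p = p
divOneMinusQ^ (suc m) p = divOneMinusQ (divOneMinusQ^ m p)

-- reduced composition polynomial f_c = g_c / (1-q)^k
redCompPoly : List ℕ → Poly
redCompPoly c = divOneMinusQ^ (length c) (compPoly c)

-- total inverse on ℚ (1/0 := 0; only ever applied to nonzero values below)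
inv : ℚ → ℚ
inv p with p ≟ 0ℚ
... | yes _  = 0ℚ
... | no p≢0 = 1/_ p {{≢-nonZero p≢0}}

β : List ℕ → ℕ → ℕ
β c j = sum (take j c)

ℕ→ℚ : ℕ → ℚ
ℕ→ℚ m = (+ m) ℚ./ 1

prodℚ : List ℚ → ℚ
prodℚ = foldr _*_ 1ℚ

sumℚ : List ℚ → ℚ
sumℚ = foldr _+_ 0ℚ

denom : List ℕ → ℕ → ℚ
denom c j = prodℚ (map (λ l → ℕ→ℚ (β c l) - ℕ→ℚ (β c j))
                       (filter (λ l → Relation.Nullary.Decidable.¬? (l ℕ.≟ j)) (upTo (suc (length c)))))
  where import Relation.Nullary.Decidable

multichoose : ℕ → ℕ → ℕ
multichoose k m = (k ℕ.+ m ∸ 1) C m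

formula : List ℕ → ℕ → ℚ
formula c i = sumℚ (map (λ j → inv (denom c j) * ℕ→ℚ (multichoose (length c) (i ∸ β c j)))
                        (filter (λ j → β c j ℕ.≤? i) (upTo (suc (length c)))))

-- The iterated integral hⱼ(t) = ∫_q^t hⱼ₋₁(s) s^(cⱼ - 1) ds is homogeneous of degree βⱼ in (t, q):
-- hⱼ = Σ_{i ≤ j} wᵢ q^βᵢ t^(βⱼ - βᵢ), where wᵢ = 1 / ∏_{l ≤ j, l ≠ i} (βₗ - βᵢ) are the Lagrange weights
-- of the nodes β₀ < ⋯ < βⱼ. Integrating divides the coefficient of qᵇ by βⱼ₊₁ - b, and the new
-- coefficient of q^βⱼ₊₁ is forced by hⱼ₊₁(q) = 0 to be minus the sum of the others; that this is the next
-- Lagrange weight is the partial-fraction identity Σᵢ wᵢ / (βᵢ - y) = 1 / ∏ᵢ (βᵢ - y), i.e. Lagrange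
-- weights of at least two nodes sum to 0. Hence g_c(q) = Σⱼ wⱼ q^βⱼ, and dividing by (1 - q)ᵏ, i.e.
-- taking k-fold partial sums of coefficients, turns q^βⱼ into Σᵢ multichoose k (i - βⱼ) qⁱ.

module Submission where

open import Defs
open import Data.Nat using (ℕ; _≤_; _∸_)
open import Data.List using (List; length)
open import Data.Nat.ListAction using (sum)
open import Data.List.Relation.Unary.All using (All)
open import Relation.Binary.PropositionalEquality using (_≡_)

open import Data.Bool using (true; false; if_then_else_)
open import Data.Integer as ℤ using ()
import Data.Integer.Properties as ℤP
import Data.Integer.Tactic.RingSolver as ℤ-Solver
open import Data.List using ([]; _∷_; _++_; _∷ʳ_; foldr; map; filter; upTo)
import Data.List.Properties as LP
open import Data.List.Relation.Unary.All using ([]; _∷_)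
import Data.List.Relation.Unary.All.Properties as AllP
open import Data.List.Reverse using (Reverse; reverseView; []; _∶_∶ʳ_)
open import Data.Nat as ℕ using (zero; suc; _<_; _≰_; _≤?_; z≤n; s≤s)
open import Data.Nat.Combinatorics using (_C_; nCk+nC[k+1]≡[n+1]C[k+1]; k>n⇒nCk≡0)
open import Data.Nat.Coprimality using (1-coprimeTo) renaming (sym to coprime-sym)
import Data.Nat.Properties as ℕP
open import Data.Product using (_,_; proj₂)
open import Relation.Binary.Definitions using (tri<; tri≈; tri>)
open import Data.Rational as ℚ using (ℚ; 0ℚ; 1ℚ; _+_; _*_; _-_; -_; mkℚ)
open import Data.Rational.Properties as ℚP using (_≟_)
import Data.Rational.Unnormalised as ℚᵘ
import Data.Rational.Unnormalised.Properties as ℚᵘP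
open import Function using (_∘_)
open import Level using (0ℓ)
open import Relation.Binary.PropositionalEquality
  using (_≢_; refl; sym; trans; cong; cong₂; subst; module ≡-Reasoning)
open import Relation.Nullary using (Dec; yes; no; does; contradiction)
open import Relation.Nullary.Decidable using (¬?; dec⇒maybe; dec-true; dec-false)
open import Algebra.Properties.Group ℚP.+-0-group using () renaming (inverseʳ-unique to +-inverseʳ-unique)
open import Tactic.RingSolver using (solve-∀)
open import Tactic.RingSolver.Core.AlmostCommutativeRing
  using (AlmostCommutativeRing; fromCommutativeRing)

ℚ-ring : AlmostCommutativeRing 0ℓ 0ℓ
ℚ-ring = fromCommutativeRing ℚP.+-*-commutativeRing (λ x → dec⇒maybe (0ℚ ≟ x))

inv-inverseʳ : ∀ {p} → p ≢ 0ℚ → p * inv p ≡ 1ℚ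
inv-inverseʳ {p} p≢0 with p ≟ 0ℚ
... | yes p≡0 = contradiction p≡0 p≢0
... | no  p≢0 = ℚP.*-inverseʳ p {{ℚ.≢-nonZero p≢0}}

inv≢0 : ∀ {p} → p ≢ 0ℚ → inv p ≢ 0ℚ
inv≢0 {p} p≢0 inv≡0 =
  ℚP.1≢0 (trans (sym (inv-inverseʳ p≢0)) (trans (cong (p *_) inv≡0) (ℚP.*-zeroʳ p)))

inv-unique : ∀ p r → p * r ≡ 1ℚ → inv p ≡ r
inv-unique p r pr≡1 = begin
  inv p              ≡⟨ ℚP.*-identityʳ (inv p) ⟨
  inv p * 1ℚ         ≡⟨ cong (inv p *_) pr≡1 ⟨
  inv p * (p * r)    ≡⟨ reassoc (inv p) p r ⟩
  p * inv p * r      ≡⟨ cong (_* r) (inv-inverseʳ p≢0) ⟩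
  1ℚ * r             ≡⟨ ℚP.*-identityˡ r ⟩
  r                  ∎
  where
  open ≡-Reasoning
  p≢0 : p ≢ 0ℚ
  p≢0 p≡0 = ℚP.1≢0 (trans (sym pr≡1) (trans (cong (_* r) p≡0) (ℚP.*-zeroˡ r)))
  reassoc : ∀ a b c → a * (b * c) ≡ b * a * c
  reassoc = solve-∀ ℚ-ring

*-inv-*-inv : ∀ {p q} → p ≢ 0ℚ → q ≢ 0ℚ → p * q * (inv p * inv q) ≡ 1ℚ
*-inv-*-inv {p} {q} p≢0 q≢0 = begin
  p * q * (inv p * inv q)    ≡⟨ regroup p q (inv p) (inv q) ⟩
  p * inv p * (q * inv q)    ≡⟨ cong₂ _*_ (inv-inverseʳ p≢0) (inv-inverseʳ q≢0) ⟩
  1ℚ * 1ℚ                    ≡⟨ ℚP.*-identityˡ 1ℚ ⟩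
  1ℚ                         ∎
  where
  open ≡-Reasoning
  regroup : ∀ a b c d → a * b * (c * d) ≡ a * c * (b * d)
  regroup = solve-∀ ℚ-ring

*-≢0 : ∀ {p q} → p ≢ 0ℚ → q ≢ 0ℚ → p * q ≢ 0ℚ
*-≢0 {p} {q} p≢0 q≢0 pq≡0 = ℚP.1≢0 (begin
  1ℚ                          ≡⟨ *-inv-*-inv p≢0 q≢0 ⟨
  p * q * (inv p * inv q)     ≡⟨ cong (_* (inv p * inv q)) pq≡0 ⟩
  0ℚ * (inv p * inv q)        ≡⟨ ℚP.*-zeroˡ (inv p * inv q) ⟩
  0ℚ                          ∎)
  where open ≡-Reasoning

inv-distrib-* : ∀ p q → inv (p * q) ≡ inv p * inv q
inv-distrib-* p q = cases (p ≟ 0ℚ) (q ≟ 0ℚ)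
  where
  cases : Dec (p ≡ 0ℚ) → Dec (q ≡ 0ℚ) → inv (p * q) ≡ inv p * inv q
  cases (yes p≡0) _ = subst (λ x → inv (x * q) ≡ inv x * inv q) (sym p≡0)
                        (trans (cong inv (ℚP.*-zeroˡ q)) (sym (ℚP.*-zeroˡ (inv q))))
  cases (no _) (yes q≡0) = subst (λ x → inv (p * x) ≡ inv p * inv x) (sym q≡0)
                             (trans (cong inv (ℚP.*-zeroʳ p)) (sym (ℚP.*-zeroʳ (inv p))))
  cases (no p≢0) (no q≢0) = inv-unique (p * q) (inv p * inv q) (*-inv-*-inv p≢0 q≢0)

inv-neg : ∀ p → inv (- p) ≡ - inv p
inv-neg p = cases (p ≟ 0ℚ)
  where
  neg*neg : ∀ a b → - a * - b ≡ a * b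
  neg*neg = solve-∀ ℚ-ring
  cases : Dec (p ≡ 0ℚ) → inv (- p) ≡ - inv p
  cases (yes p≡0) = subst (λ x → inv (- x) ≡ - inv x) (sym p≡0) refl
  cases (no p≢0)  = inv-unique (- p) (- inv p) (trans (neg*neg p (inv p)) (inv-inverseʳ p≢0))

inv-flip : ∀ p q → inv (p - q) ≡ - inv (q - p)
inv-flip p q = trans (cong inv (flip p q)) (inv-neg (q - p))
  where
  flip : ∀ a b → a - b ≡ - (b - a)
  flip = solve-∀ ℚ-ring

p≢q⇒p-q≢0 : ∀ {p q} → p ≢ q → p - q ≢ 0ℚ
p≢q⇒p-q≢0 {p} {q} p≢q p-q≡0 = p≢q (begin
  p              ≡⟨ split p q ⟩
  (p - q) + q    ≡⟨ cong (_+ q) p-q≡0 ⟩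
  0ℚ + q         ≡⟨ ℚP.+-identityˡ q ⟩
  q              ∎)
  where
  open ≡-Reasoning
  split : ∀ a b → a ≡ (a - b) + b
  split = solve-∀ ℚ-ring

inv-*-split : ∀ {p r} → p ≢ 0ℚ → r ≢ 0ℚ → p + r ≢ 0ℚ →
              inv (p * r) ≡ inv (p + r) * (inv p + inv r)
inv-*-split {p} {r} p≢0 r≢0 p+r≢0 = sym (begin
  inv (p + r) * (inv p + inv r)                    ≡⟨ cong (inv (p + r) *_) sum≡ ⟨
  inv (p + r) * ((p + r) * (inv p * inv r))        ≡⟨ reassoc (inv (p + r)) (p + r) (inv p * inv r) ⟩
  (p + r) * inv (p + r) * (inv p * inv r)          ≡⟨ cong (_* (inv p * inv r)) (inv-inverseʳ p+r≢0) ⟩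
  1ℚ * (inv p * inv r)                             ≡⟨ ℚP.*-identityˡ _ ⟩
  inv p * inv r                                    ≡⟨ inv-distrib-* p r ⟨
  inv (p * r)                                      ∎)
  where
  open ≡-Reasoning
  reassoc : ∀ a b c → a * (b * c) ≡ b * a * c
  reassoc = solve-∀ ℚ-ring
  expand : ∀ a b c d → (a + b) * (c * d) ≡ a * c * d + b * d * c
  expand = solve-∀ ℚ-ring
  sum≡ : (p + r) * (inv p * inv r) ≡ inv p + inv r
  sum≡ = begin
    (p + r) * (inv p * inv r)              ≡⟨ expand p r (inv p) (inv r) ⟩
    p * inv p * inv r + r * inv r * inv p
      ≡⟨ cong₂ (λ a b → a * inv r + b * inv p) (inv-inverseʳ p≢0) (inv-inverseʳ r≢0) ⟩
    1ℚ * inv r + 1ℚ * inv p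
      ≡⟨ cong₂ _+_ (ℚP.*-identityˡ (inv r)) (ℚP.*-identityˡ (inv p)) ⟩
    inv r + inv p                          ≡⟨ ℚP.+-comm (inv r) (inv p) ⟩
    inv p + inv r                          ∎

ℕ→ℚ≡mkℚ : ∀ m → ℕ→ℚ m ≡ mkℚ (ℤ.+ m) 0 (coprime-sym (1-coprimeTo m))
ℕ→ℚ≡mkℚ m = ℚP.normalize-coprime (coprime-sym (1-coprimeTo m))

ℕ→ℚ-homo-+ : ∀ m n → ℕ→ℚ (m ℕ.+ n) ≡ ℕ→ℚ m + ℕ→ℚ n
ℕ→ℚ-homo-+ m n = ℚP.toℚᵘ-injective
  (ℚᵘP.≃-trans toℚᵘ-sum (ℚᵘP.≃-sym (ℚP.toℚᵘ-homo-+ (ℕ→ℚ m) (ℕ→ℚ n))))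
  where
  over1 : ∀ x y → (x ℤ.+ y) ℤ.* ℤ.1ℤ ≡ (x ℤ.* ℤ.1ℤ ℤ.+ y ℤ.* ℤ.1ℤ) ℤ.* ℤ.1ℤ
  over1 = ℤ-Solver.solve-∀
  toℚᵘ-sum : ℚ.toℚᵘ (ℕ→ℚ (m ℕ.+ n)) ℚᵘ.≃ ℚ.toℚᵘ (ℕ→ℚ m) ℚᵘ.+ ℚ.toℚᵘ (ℕ→ℚ n)
  toℚᵘ-sum rewrite ℕ→ℚ≡mkℚ (m ℕ.+ n) | ℕ→ℚ≡mkℚ m | ℕ→ℚ≡mkℚ n | ℤP.pos-+ m n =
    ℚᵘ.*≡* (over1 (ℤ.+ m) (ℤ.+ n))

ℕ→ℚ-injective : ∀ {m n} → ℕ→ℚ m ≡ ℕ→ℚ n → m ≡ n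
ℕ→ℚ-injective {m} {n} eq =
  ℤP.+-injective (cong ℚ.numerator (trans (sym (ℕ→ℚ≡mkℚ m)) (trans eq (ℕ→ℚ≡mkℚ n))))

ℕ→ℚ-∸ : ∀ {m n} → m ≤ n → ℕ→ℚ n - ℕ→ℚ m ≡ ℕ→ℚ (n ∸ m)
ℕ→ℚ-∸ {m} {n} m≤n = begin
  ℕ→ℚ n - ℕ→ℚ m                     ≡⟨ cong (λ k → ℕ→ℚ k - ℕ→ℚ m) (ℕP.m∸n+n≡m m≤n) ⟨
  ℕ→ℚ (n ∸ m ℕ.+ m) - ℕ→ℚ m         ≡⟨ cong (_- ℕ→ℚ m) (ℕ→ℚ-homo-+ (n ∸ m) m) ⟩
  ℕ→ℚ (n ∸ m) + ℕ→ℚ m - ℕ→ℚ m       ≡⟨ cancel (ℕ→ℚ (n ∸ m)) (ℕ→ℚ m) ⟩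
  ℕ→ℚ (n ∸ m)                       ∎
  where
  open ≡-Reasoning
  cancel : ∀ a b → a + b - b ≡ a
  cancel = solve-∀ ℚ-ring

1/suc≡inv : ∀ e → ℤ.1ℤ ℚ./ suc e ≡ inv (ℕ→ℚ (suc e))
1/suc≡inv e rewrite ℕ→ℚ≡mkℚ (suc e) = ℚP.normalize-coprime (1-coprimeTo (suc e))

module Fold (_∙_ : ℚ → ℚ → ℚ) (ε : ℚ)
            (identityˡ : ∀ x → ε ∙ x ≡ x) (identityʳ : ∀ x → x ∙ ε ≡ x)
            (assoc : ∀ x y z → (x ∙ y) ∙ z ≡ x ∙ (y ∙ z)) where

  fold< : ℕ → (ℕ → ℚ) → ℚ
  fold< zero    f = ε
  fold< (suc n) f = fold< n f ∙ f n

  fold<-cong : ∀ n {f g : ℕ → ℚ} → (∀ {l} → l < n → f l ≡ g l) → fold< n f ≡ fold< n g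
  fold<-cong zero    f≗g = refl
  fold<-cong (suc n) f≗g = cong₂ _∙_ (fold<-cong n (f≗g ∘ ℕP.m<n⇒m<1+n)) (f≗g (ℕP.n<1+n n))

  foldr-++ : ∀ xs ys → foldr _∙_ ε (xs ++ ys) ≡ foldr _∙_ ε xs ∙ foldr _∙_ ε ys
  foldr-++ []       ys = sym (identityˡ _)
  foldr-++ (x ∷ xs) ys = trans (cong (x ∙_) (foldr-++ xs ys)) (sym (assoc x _ _))

  foldr-map-upTo : ∀ n (f : ℕ → ℚ) → foldr _∙_ ε (map f (upTo n)) ≡ fold< n f
  foldr-map-upTo zero    f = refl
  foldr-map-upTo (suc n) f = begin
    foldr _∙_ ε (map f (upTo (suc n)))        ≡⟨ cong (foldr _∙_ ε ∘ map f) (LP.upTo-∷ʳ n) ⟨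
    foldr _∙_ ε (map f (upTo n ∷ʳ n))         ≡⟨ cong (foldr _∙_ ε) (LP.map-++ f (upTo n) (n ∷ [])) ⟩
    foldr _∙_ ε (map f (upTo n) ∷ʳ f n)       ≡⟨ foldr-++ (map f (upTo n)) (f n ∷ []) ⟩
    foldr _∙_ ε (map f (upTo n)) ∙ (f n ∙ ε)  ≡⟨ cong₂ _∙_ (foldr-map-upTo n f) (identityʳ (f n)) ⟩
    fold< n f ∙ f n                           ∎
    where open ≡-Reasoning

  foldr-map-filter : ∀ {P : ℕ → Set} (P? : ∀ l → Dec (P l)) (f : ℕ → ℚ) xs →
    foldr _∙_ ε (map f (filter P? xs)) ≡ foldr _∙_ ε (map (λ l → if does (P? l) then f l else ε) xs)
  foldr-map-filter P? f []       = refl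
  foldr-map-filter P? f (x ∷ xs) with does (P? x)
  ... | true  = cong (f x ∙_) (foldr-map-filter P? f xs)
  ... | false = trans (foldr-map-filter P? f xs) (sym (identityˡ _))

open Fold _+_ 0ℚ ℚP.+-identityˡ ℚP.+-identityʳ ℚP.+-assoc public
  using () renaming (fold< to ∑; fold<-cong to ∑-cong;
                     foldr-map-upTo to sumℚ-map-upTo; foldr-map-filter to sumℚ-map-filter)
open Fold _*_ 1ℚ ℚP.*-identityˡ ℚP.*-identityʳ ℚP.*-assoc public
  using () renaming (fold< to ∏; fold<-cong to ∏-cong;
                     foldr-map-upTo to prodℚ-map-upTo; foldr-map-filter to prodℚ-map-filter)

∑-≡0 : ∀ n {f} → (∀ {j} → j < n → f j ≡ 0ℚ) → ∑ n f ≡ 0ℚ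
∑-≡0 zero    f≡0 = refl
∑-≡0 (suc n) f≡0 =
  trans (cong₂ _+_ (∑-≡0 n (f≡0 ∘ ℕP.m<n⇒m<1+n)) (f≡0 (ℕP.n<1+n n))) (ℚP.+-identityʳ 0ℚ)

∑-single : ∀ n {t f} → t < n → (∀ {j} → j < n → j ≢ t → f j ≡ 0ℚ) → ∑ n f ≡ f t
∑-single (suc n) {t} {f} t<1+n others with t ℕ.≟ n
... | yes refl = begin
  ∑ t f + f t     ≡⟨ cong (_+ f t) (∑-≡0 t λ j<t → others (ℕP.m<n⇒m<1+n j<t) (ℕP.<⇒≢ j<t)) ⟩
  0ℚ + f t        ≡⟨ ℚP.+-identityˡ (f t) ⟩
  f t             ∎
  where open ≡-Reasoning
... | no t≢n = begin
  ∑ n f + f n     ≡⟨ cong₂ _+_ (∑-single n t<n (others ∘ ℕP.m<n⇒m<1+n)) (others (ℕP.n<1+n n) (t≢n ∘ sym)) ⟩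
  f t + 0ℚ        ≡⟨ ℚP.+-identityʳ (f t) ⟩
  f t             ∎
  where
  open ≡-Reasoning
  t<n = ℕP.≤∧≢⇒< (ℕP.≤-pred t<1+n) t≢n

∑-unfoldˡ : ∀ n f → ∑ (suc n) f ≡ f 0 + ∑ n (f ∘ suc)
∑-unfoldˡ zero    f = trans (ℚP.+-identityˡ (f 0)) (sym (ℚP.+-identityʳ (f 0)))
∑-unfoldˡ (suc n) f = trans (cong (_+ f (suc n)) (∑-unfoldˡ n f)) (ℚP.+-assoc (f 0) _ _)

∑-distrib-+ : ∀ n f g → ∑ n (λ j → f j + g j) ≡ ∑ n f + ∑ n g
∑-distrib-+ zero    f g = sym (ℚP.+-identityʳ 0ℚ)
∑-distrib-+ (suc n) f g =
  trans (cong (_+ (f n + g n)) (∑-distrib-+ n f g)) (interchange (∑ n f) (∑ n g) (f n) (g n))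
  where
  interchange : ∀ a b c d → a + b + (c + d) ≡ a + c + (b + d)
  interchange = solve-∀ ℚ-ring

∑-neg : ∀ n f → ∑ n (λ j → - f j) ≡ - ∑ n f
∑-neg zero    f = refl
∑-neg (suc n) f = trans (cong (_+ - f n) (∑-neg n f)) (sym (ℚP.neg-distrib-+ (∑ n f) (f n)))

∑-distrib-- : ∀ n f g → ∑ n (λ j → f j - g j) ≡ ∑ n f - ∑ n g
∑-distrib-- n f g = trans (∑-distrib-+ n f (-_ ∘ g)) (cong (∑ n f +_) (∑-neg n g))

∑-distribˡ-* : ∀ n r f → ∑ n (λ j → r * f j) ≡ r * ∑ n f
∑-distribˡ-* zero    r f = sym (ℚP.*-zeroʳ r)
∑-distribˡ-* (suc n) r f =
  trans (cong (_+ r * f n) (∑-distribˡ-* n r f)) (sym (ℚP.*-distribˡ-+ r (∑ n f) (f n)))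

∑-comm : ∀ m n (F : ℕ → ℕ → ℚ) → ∑ m (λ a → ∑ n (F a)) ≡ ∑ n (λ b → ∑ m (λ a → F a b))
∑-comm zero    n F = sym (∑-≡0 n (λ _ → refl))
∑-comm (suc m) n F =
  trans (cong (_+ ∑ n (F m)) (∑-comm m n F)) (sym (∑-distrib-+ n (λ b → ∑ m (λ a → F a b)) (F m)))

∏≢0 : ∀ n {f} → (∀ {l} → l < n → f l ≢ 0ℚ) → ∏ n f ≢ 0ℚ
∏≢0 zero    f≢0 = ℚP.1≢0
∏≢0 (suc n) f≢0 = *-≢0 (∏≢0 n (f≢0 ∘ ℕP.m<n⇒m<1+n)) (f≢0 (ℕP.n<1+n n))

δ : ℕ → ℕ → ℚ
δ s b = if does (s ℕ.≟ b) then 1ℚ else 0ℚ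

δ-≡ : ∀ s → δ s s ≡ 1ℚ
δ-≡ s = cong (λ b → if b then 1ℚ else 0ℚ) (dec-true (s ℕ.≟ s) refl)

δ-≢ : ∀ {s b} → s ≢ b → δ s b ≡ 0ℚ
δ-≢ {s} {b} s≢b = cong (λ b → if b then 1ℚ else 0ℚ) (dec-false (s ℕ.≟ b) s≢b)

∑-δ : ∀ n {s} → s < n → ∑ n (δ s) ≡ 1ℚ
∑-δ n {s} s<n = trans (∑-single n s<n (λ _ j≢s → δ-≢ (j≢s ∘ sym))) (δ-≡ s)

-- Phrased with ¬? so that the filter in denom turns into ∏-except under prodℚ-map-filter.
omit : ℕ → (ℕ → ℚ) → ℕ → ℚ
omit j f l = if does (¬? (l ℕ.≟ j)) then f l else 1ℚ

omit-≢ : ∀ {j l} f → l ≢ j → omit j f l ≡ f l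
omit-≢ {j} {l} f l≢j = cong (λ b → if b then f l else 1ℚ) (dec-true (¬? (l ℕ.≟ j)) l≢j)

omit-≡ : ∀ j f → omit j f j ≡ 1ℚ
omit-≡ j f = cong (λ b → if b then f j else 1ℚ) (dec-false (¬? (j ℕ.≟ j)) (λ j≢j → j≢j refl))

∏-except : ℕ → ℕ → (ℕ → ℚ) → ℚ
∏-except n j f = ∏ n (omit j f)

∏-except-suc : ∀ n j f → n ≢ j → ∏-except (suc n) j f ≡ ∏-except n j f * f n
∏-except-suc n j f n≢j = cong (∏-except n j f *_) (omit-≢ f n≢j)

∏-except-last : ∀ n f → ∏-except (suc n) n f ≡ ∏ n f
∏-except-last n f = begin
  ∏-except n n f * omit n f n   ≡⟨ cong (∏-except n n f *_) (omit-≡ n f) ⟩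
  ∏-except n n f * 1ℚ           ≡⟨ ℚP.*-identityʳ _ ⟩
  ∏-except n n f                ≡⟨ ∏-cong n (λ l<n → omit-≢ f (ℕP.<⇒≢ l<n)) ⟩
  ∏ n f                         ∎
  where open ≡-Reasoning

∏-except≢0 : ∀ n j {f} → (∀ {l} → l < n → l ≢ j → f l ≢ 0ℚ) → ∏-except n j f ≢ 0ℚ
∏-except≢0 n j {f} f≢0 = ∏≢0 n factor≢0
  where
  factor≢0 : ∀ {l} → l < n → omit j f l ≢ 0ℚ
  factor≢0 {l} l<n with l ℕ.≟ j
  ... | yes refl = subst (_≢ 0ℚ) (sym (omit-≡ j f)) ℚP.1≢0
  ... | no  l≢j  = subst (_≢ 0ℚ) (sym (omit-≢ f l≢j)) (f≢0 l<n l≢j)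

Distinct : (ℕ → ℚ) → ℕ → Set
Distinct x n = ∀ {i j} → i < n → j < n → x i ≡ x j → i ≡ j

Distinct-pred : ∀ {x n} → Distinct x (suc n) → Distinct x n
Distinct-pred distinct i<n j<n = distinct (ℕP.m<n⇒m<1+n i<n) (ℕP.m<n⇒m<1+n j<n)

lagrangeWeight : (ℕ → ℚ) → ℕ → ℕ → ℚ
lagrangeWeight x k j = inv (∏-except (suc k) j (λ l → x l - x j))

lagrangeWeight-suc : ∀ x k {j} → j < suc k →
                     lagrangeWeight x (suc k) j ≡ lagrangeWeight x k j * inv (x (suc k) - x j)
lagrangeWeight-suc x k {j} j<1+k =
  trans (cong inv (∏-except-suc (suc k) j _ (ℕP.<⇒≢ j<1+k ∘ sym)))
        (inv-distrib-* (∏-except (suc k) j (λ l → x l - x j)) (x (suc k) - x j))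

lagrangeWeight-last : ∀ x k → lagrangeWeight x k k ≡ inv (∏ k (λ l → x l - x k))
lagrangeWeight-last x k = cong inv (∏-except-last k _)

lagrangeWeight≢0 : ∀ {x k j} → Distinct x (suc k) → j < suc k → lagrangeWeight x k j ≢ 0ℚ
lagrangeWeight≢0 {x} {k} {j} distinct j<1+k =
  inv≢0 (∏-except≢0 (suc k) j (λ l<1+k l≢j → p≢q⇒p-q≢0 (l≢j ∘ distinct l<1+k j<1+k)))

partialFraction : ∀ {a y z} → a ≢ y → a ≢ z → z ≢ y →
                  inv (z - a) * inv (a - y) ≡ inv (z - y) * (inv (a - y) - inv (a - z))
partialFraction {a} {y} {z} a≢y a≢z z≢y = begin
  inv (z - a) * inv (a - y)                        ≡⟨ ℚP.*-comm (inv (z - a)) (inv (a - y)) ⟩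
  inv (a - y) * inv (z - a)                        ≡⟨ inv-distrib-* (a - y) (z - a) ⟨
  inv ((a - y) * (z - a))
    ≡⟨ inv-*-split (p≢q⇒p-q≢0 a≢y) (p≢q⇒p-q≢0 (a≢z ∘ sym)) a-y+z-a≢0 ⟩
  inv ((a - y) + (z - a)) * (inv (a - y) + inv (z - a))
    ≡⟨ cong₂ (λ s t → inv s * (inv (a - y) + t)) (telescope a y z) (inv-flip z a) ⟩
  inv (z - y) * (inv (a - y) - inv (a - z))        ∎
  where
  open ≡-Reasoning
  telescope : ∀ a y z → (a - y) + (z - a) ≡ z - y
  telescope = solve-∀ ℚ-ring
  a-y+z-a≢0 : (a - y) + (z - a) ≢ 0ℚ
  a-y+z-a≢0 = subst (_≢ 0ℚ) (sym (telescope a y z)) (p≢q⇒p-q≢0 z≢y)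

lagrange-partialFractions : ∀ x k {y} → Distinct x (suc k) → (∀ {j} → j < suc k → x j ≢ y) →
  ∑ (suc k) (λ j → lagrangeWeight x k j * inv (x j - y)) ≡ inv (∏ (suc k) (λ l → x l - y))
lagrange-partialFractions x zero {y} _ _ = begin
  0ℚ + 1ℚ * inv (x 0 - y)     ≡⟨ ℚP.+-identityˡ _ ⟩
  1ℚ * inv (x 0 - y)          ≡⟨ ℚP.*-identityˡ _ ⟩
  inv (x 0 - y)               ≡⟨ cong inv (ℚP.*-identityˡ (x 0 - y)) ⟨
  inv (1ℚ * (x 0 - y))        ∎
  where open ≡-Reasoning
lagrange-partialFractions x (suc k) {y} distinct x≢y = begin
  ∑ (suc k) T + T (suc k)
    ≡⟨ cong₂ _+_ (∑-cong (suc k) T≡) T-last ⟩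
  ∑ (suc k) (λ j → inv (z - y) * (Y j - Z j)) + ∑ (suc k) Z * inv (z - y)
    ≡⟨ cong (_+ ∑ (suc k) Z * inv (z - y))
            (trans (∑-distribˡ-* (suc k) (inv (z - y)) _) (cong (inv (z - y) *_) (∑-distrib-- (suc k) Y Z))) ⟩
  inv (z - y) * (∑ (suc k) Y - ∑ (suc k) Z) + ∑ (suc k) Z * inv (z - y)
    ≡⟨ cancel (inv (z - y)) (∑ (suc k) Y) (∑ (suc k) Z) ⟩
  ∑ (suc k) Y * inv (z - y)
    ≡⟨ cong (_* inv (z - y)) (lagrange-partialFractions x k distinct′ (x≢y ∘ ℕP.m<n⇒m<1+n)) ⟩
  inv (∏ (suc k) (λ l → x l - y)) * inv (z - y)
    ≡⟨ inv-distrib-* (∏ (suc k) (λ l → x l - y)) (z - y) ⟨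
  inv (∏ (suc (suc k)) (λ l → x l - y)) ∎
  where
  open ≡-Reasoning
  z = x (suc k)
  distinct′ = Distinct-pred distinct
  T Y Z : ℕ → ℚ
  T j = lagrangeWeight x (suc k) j * inv (x j - y)
  Y j = lagrangeWeight x k j * inv (x j - y)
  Z j = lagrangeWeight x k j * inv (x j - z)
  cancel : ∀ a b c → a * (b - c) + c * a ≡ b * a
  cancel = solve-∀ ℚ-ring
  distribute : ∀ w c p q → w * (c * (p - q)) ≡ c * (w * p - w * q)
  distribute = solve-∀ ℚ-ring
  x≢z : ∀ {j} → j < suc k → x j ≢ z
  x≢z j<1+k eq = ℕP.<⇒≢ j<1+k (distinct (ℕP.m<n⇒m<1+n j<1+k) (ℕP.n<1+n (suc k)) eq)
  T≡ : ∀ {j} → j < suc k → T j ≡ inv (z - y) * (Y j - Z j)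
  T≡ {j} j<1+k = begin
    lagrangeWeight x (suc k) j * inv (x j - y)
      ≡⟨ cong (_* inv (x j - y)) (lagrangeWeight-suc x k j<1+k) ⟩
    lagrangeWeight x k j * inv (z - x j) * inv (x j - y)
      ≡⟨ ℚP.*-assoc (lagrangeWeight x k j) _ _ ⟩
    lagrangeWeight x k j * (inv (z - x j) * inv (x j - y))
      ≡⟨ cong (lagrangeWeight x k j *_)
              (partialFraction (x≢y (ℕP.m<n⇒m<1+n j<1+k)) (x≢z j<1+k) (x≢y (ℕP.n<1+n (suc k)))) ⟩
    lagrangeWeight x k j * (inv (z - y) * (inv (x j - y) - inv (x j - z)))
      ≡⟨ distribute (lagrangeWeight x k j) (inv (z - y)) _ _ ⟩
    inv (z - y) * (Y j - Z j) ∎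
  T-last : T (suc k) ≡ ∑ (suc k) Z * inv (z - y)
  T-last = cong (_* inv (z - y)) (trans (lagrangeWeight-last x (suc k))
             (sym (lagrange-partialFractions x k distinct′ x≢z)))

∑-lagrangeWeight : ∀ x k → Distinct x (suc (suc k)) → ∑ (suc (suc k)) (lagrangeWeight x (suc k)) ≡ 0ℚ
∑-lagrangeWeight x k distinct = begin
  ∑ (suc k) (lagrangeWeight x (suc k)) + lagrangeWeight x (suc k) (suc k)
    ≡⟨ cong₂ _+_ (∑-cong (suc k) w≡) (lagrangeWeight-last x (suc k)) ⟩
  ∑ (suc k) (λ j → - Z j) + inv (∏ (suc k) (λ l → x l - z))
    ≡⟨ cong₂ _+_ (∑-neg (suc k) Z) (sym (lagrange-partialFractions x k (Distinct-pred distinct) x≢z)) ⟩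
  - ∑ (suc k) Z + ∑ (suc k) Z
    ≡⟨ ℚP.+-inverseˡ (∑ (suc k) Z) ⟩
  0ℚ ∎
  where
  open ≡-Reasoning
  z = x (suc k)
  Z : ℕ → ℚ
  Z j = lagrangeWeight x k j * inv (x j - z)
  x≢z : ∀ {j} → j < suc k → x j ≢ z
  x≢z j<1+k eq = ℕP.<⇒≢ j<1+k (distinct (ℕP.m<n⇒m<1+n j<1+k) (ℕP.n<1+n (suc k)) eq)
  w≡ : ∀ {j} → j < suc k → lagrangeWeight x (suc k) j ≡ - Z j
  w≡ {j} j<1+k = begin
    lagrangeWeight x (suc k) j                ≡⟨ lagrangeWeight-suc x k j<1+k ⟩
    lagrangeWeight x k j * inv (z - x j)      ≡⟨ cong (lagrangeWeight x k j *_) (inv-flip z (x j)) ⟩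
    lagrangeWeight x k j * - inv (x j - z)    ≡⟨ ℚP.neg-distribʳ-* (lagrangeWeight x k j) _ ⟨
    - Z j                                     ∎

lagrangeWeight-cong : ∀ {x y} k {j} → (∀ {l} → l < suc k → x l ≡ y l) → j < suc k →
                      lagrangeWeight x k j ≡ lagrangeWeight y k j
lagrangeWeight-cong k {j} x≗y j<1+k = cong inv (∏-cong (suc k) λ {l} l<1+k →
  cong (λ t → if does (¬? (l ℕ.≟ j)) then t else 1ℚ) (cong₂ _-_ (x≗y l<1+k) (x≗y j<1+k)))

Ascending : (ℕ → ℕ) → ℕ → Set
Ascending B k = ∀ {l} → l < k → B l < B (suc l)

Ascending-mono : ∀ {B j k} → j ≤ k → Ascending B k → Ascending B j
Ascending-mono j≤k asc l<j = asc (ℕP.<-≤-trans l<j j≤k)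

ascending-≤ : ∀ {B k} → Ascending B k → ∀ {j} → j ≤ k → B j ≤ B k
ascending-≤ {B} {zero}  asc z≤n = ℕP.≤-refl
ascending-≤ {B} {suc k} asc {j} j≤1+k with j ℕ.≟ suc k
... | yes refl   = ℕP.≤-refl
... | no j≢1+k   = ℕP.≤-trans (ascending-≤ (Ascending-mono (ℕP.n≤1+n k) asc)
                                            (ℕP.≤-pred (ℕP.≤∧≢⇒< j≤1+k j≢1+k)))
                              (ℕP.<⇒≤ (asc (ℕP.n<1+n k)))

ascending-< : ∀ {B k} → Ascending B k → ∀ {j} → j < k → B j < B k
ascending-< {B} {suc k} asc j<1+k =
  ℕP.≤-<-trans (ascending-≤ (Ascending-mono (ℕP.n≤1+n k) asc) (ℕP.≤-pred j<1+k)) (asc (ℕP.n<1+n k))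

ascending⇒distinct : ∀ {B k} → Ascending B k → Distinct (ℕ→ℚ ∘ B) (suc k)
ascending⇒distinct {B} asc {i} {j} i<1+k j<1+k Bi≡Bj with ℕP.<-cmp i j
... | tri< i<j _ _ = contradiction (ℕ→ℚ-injective Bi≡Bj)
                       (ℕP.<⇒≢ (ascending-< (Ascending-mono (ℕP.≤-pred j<1+k) asc) i<j))
... | tri≈ _ i≡j _ = i≡j
... | tri> _ _ j<i = contradiction (sym (ℕ→ℚ-injective Bi≡Bj))
                       (ℕP.<⇒≢ (ascending-< (Ascending-mono (ℕP.≤-pred i<1+k) asc) j<i))

nodeCoeff : (ℕ → ℕ) → ℕ → ℕ → ℚ
nodeCoeff B k b = ∑ (suc k) (λ j → lagrangeWeight (ℕ→ℚ ∘ B) k j * δ (B j) b)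

*δ-cong : ∀ {s b p q} → (s ≡ b → p ≡ q) → p * δ s b ≡ q * δ s b
*δ-cong {s} {b} {p} {q} p≡q with s ℕ.≟ b
... | yes s≡b = cong (_* δ s b) (p≡q s≡b)
... | no  s≢b = begin
  p * δ s b    ≡⟨ cong (p *_) (δ-≢ s≢b) ⟩
  p * 0ℚ       ≡⟨ ℚP.*-zeroʳ p ⟩
  0ℚ           ≡⟨ ℚP.*-zeroʳ q ⟨
  q * 0ℚ       ≡⟨ cong (q *_) (δ-≢ s≢b) ⟨
  q * δ s b    ∎
  where open ≡-Reasoning

nodeCoeff-cong : ∀ {B B′} k b → (∀ {l} → l < suc k → B l ≡ B′ l) →
                 nodeCoeff B k b ≡ nodeCoeff B′ k b
nodeCoeff-cong k b B≗B′ = ∑-cong (suc k) λ j<1+k →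
  cong₂ _*_ (lagrangeWeight-cong k (cong ℕ→ℚ ∘ B≗B′) j<1+k) (cong (λ s → δ s b) (B≗B′ j<1+k))

nodeCoeff-above : ∀ {B k b} → Ascending B k → B k < b → nodeCoeff B k b ≡ 0ℚ
nodeCoeff-above {B} {k} asc Bk<b = ∑-≡0 (suc k) λ {j} j<1+k →
  trans (cong (lagrangeWeight (ℕ→ℚ ∘ B) k j *_)
              (δ-≢ (ℕP.<⇒≢ (ℕP.≤-<-trans (ascending-≤ asc (ℕP.≤-pred j<1+k)) Bk<b))))
        (ℚP.*-zeroʳ (lagrangeWeight (ℕ→ℚ ∘ B) k j))

nodeCoeff-last : ∀ {B k} → Ascending B k → nodeCoeff B k (B k) ≡ lagrangeWeight (ℕ→ℚ ∘ B) k k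
nodeCoeff-last {B} {k} asc = begin
  nodeCoeff B k (B k)           ≡⟨ ∑-single (suc k) (ℕP.n<1+n k) off-diagonal ⟩
  w k * δ (B k) (B k)           ≡⟨ cong (w k *_) (δ-≡ (B k)) ⟩
  w k * 1ℚ                      ≡⟨ ℚP.*-identityʳ (w k) ⟩
  w k                           ∎
  where
  open ≡-Reasoning
  w = lagrangeWeight (ℕ→ℚ ∘ B) k
  off-diagonal : ∀ {j} → j < suc k → j ≢ k → w j * δ (B j) (B k) ≡ 0ℚ
  off-diagonal {j} j<1+k j≢k =
    trans (cong (w j *_) (δ-≢ (ℕP.<⇒≢ (ascending-< asc (ℕP.≤∧≢⇒< (ℕP.≤-pred j<1+k) j≢k)))))
          (ℚP.*-zeroʳ (w j))

nodeCoeff-suc : ∀ B k {b} → b < B (suc k) →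
                nodeCoeff B (suc k) b ≡ inv (ℕ→ℚ (B (suc k) ∸ b)) * nodeCoeff B k b
nodeCoeff-suc B k {b} b<D = begin
  ∑ (suc k) (λ j → w′ j * δ (B j) b) + w′ (suc k) * δ D b
    ≡⟨ cong₂ _+_ (∑-cong (suc k) rescale) (trans (cong (w′ (suc k) *_) (δ-≢ (ℕP.<⇒≢ b<D ∘ sym)))
                                                 (ℚP.*-zeroʳ (w′ (suc k)))) ⟩
  ∑ (suc k) (λ j → c * (w j * δ (B j) b)) + 0ℚ
    ≡⟨ ℚP.+-identityʳ _ ⟩
  ∑ (suc k) (λ j → c * (w j * δ (B j) b))
    ≡⟨ ∑-distribˡ-* (suc k) c _ ⟩
  c * nodeCoeff B k b ∎
  where
  open ≡-Reasoning
  D = B (suc k)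
  c = inv (ℕ→ℚ (D ∸ b))
  w = lagrangeWeight (ℕ→ℚ ∘ B) k
  w′ = lagrangeWeight (ℕ→ℚ ∘ B) (suc k)
  rescale : ∀ {j} → j < suc k → w′ j * δ (B j) b ≡ c * (w j * δ (B j) b)
  rescale {j} j<1+k = begin
    w′ j * δ (B j) b                             ≡⟨ cong (_* δ (B j) b) (lagrangeWeight-suc (ℕ→ℚ ∘ B) k j<1+k) ⟩
    w j * inv (ℕ→ℚ D - ℕ→ℚ (B j)) * δ (B j) b   ≡⟨ *δ-cong {B j} {b} (cong (λ t → w j * inv t) ∘ D-Bj≡D∸b) ⟩
    w j * c * δ (B j) b                          ≡⟨ cong (_* δ (B j) b) (ℚP.*-comm (w j) c) ⟩
    c * w j * δ (B j) b                          ≡⟨ ℚP.*-assoc c (w j) _ ⟩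
    c * (w j * δ (B j) b)                        ∎
    where
    D-Bj≡D∸b : B j ≡ b → ℕ→ℚ D - ℕ→ℚ (B j) ≡ ℕ→ℚ (D ∸ b)
    D-Bj≡D∸b Bj≡b = trans (cong (λ s → ℕ→ℚ D - ℕ→ℚ s) Bj≡b) (ℕ→ℚ-∸ (ℕP.<⇒≤ b<D))

∑-nodeCoeff : ∀ {B k} → Ascending B k →
              ∑ (suc (B k)) (nodeCoeff B k) ≡ ∑ (suc k) (lagrangeWeight (ℕ→ℚ ∘ B) k)
∑-nodeCoeff {B} {k} asc = begin
  ∑ (suc (B k)) (λ b → ∑ (suc k) (λ j → w j * δ (B j) b))   ≡⟨ ∑-comm (suc (B k)) (suc k) _ ⟩
  ∑ (suc k) (λ j → ∑ (suc (B k)) (λ b → w j * δ (B j) b))   ≡⟨ ∑-cong (suc k) total ⟩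
  ∑ (suc k) w                                               ∎
  where
  open ≡-Reasoning
  w = lagrangeWeight (ℕ→ℚ ∘ B) k
  total : ∀ {j} → j < suc k → ∑ (suc (B k)) (λ b → w j * δ (B j) b) ≡ w j
  total {j} j<1+k = begin
    ∑ (suc (B k)) (λ b → w j * δ (B j) b)   ≡⟨ ∑-distribˡ-* (suc (B k)) (w j) (δ (B j)) ⟩
    w j * ∑ (suc (B k)) (δ (B j))           ≡⟨ cong (w j *_) (∑-δ (suc (B k)) (s≤s Bj≤Bk)) ⟩
    w j * 1ℚ                                ≡⟨ ℚP.*-identityʳ (w j) ⟩
    w j                                     ∎
    where Bj≤Bk = ascending-≤ asc (ℕP.≤-pred j<1+k)

coeff-⊕ : ∀ p q i → coeff (p ⊕ q) i ≡ coeff p i + coeff q i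
coeff-⊕ []      q       i       = sym (ℚP.+-identityˡ _)
coeff-⊕ (a ∷ p) []      i       = sym (ℚP.+-identityʳ _)
coeff-⊕ (a ∷ p) (b ∷ q) zero    = refl
coeff-⊕ (a ∷ p) (b ∷ q) (suc i) = coeff-⊕ p q i

coeff-scale : ∀ c p i → coeff (scale c p) i ≡ c * coeff p i
coeff-scale c []      i       = sym (ℚP.*-zeroʳ c)
coeff-scale c (a ∷ p) zero    = refl
coeff-scale c (a ∷ p) (suc i) = coeff-scale c p i

coeff-⊖ : ∀ p i → coeff (⊖ p) i ≡ - coeff p i
coeff-⊖ p i = trans (coeff-scale (- 1ℚ) p i) (-1* (coeff p i))
  where
  -1* : ∀ x → - 1ℚ * x ≡ - x
  -1* = solve-∀ ℚ-ring

coeff-0∷[] : ∀ i → coeff (0ℚ ∷ []) i ≡ 0ℚ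
coeff-0∷[] zero    = refl
coeff-0∷[] (suc i) = refl

coeff-0* : ∀ p i → coeff (scale 0ℚ p) i ≡ 0ℚ
coeff-0* p i = trans (coeff-scale 0ℚ p i) (ℚP.*-zeroˡ (coeff p i))

coeff-X⊗-zero : ∀ p → coeff (X ⊗ p) 0 ≡ 0ℚ
coeff-X⊗-zero p =
  trans (coeff-⊕ (scale 0ℚ p) _ 0) (trans (cong (_+ 0ℚ) (coeff-0* p 0)) (ℚP.+-identityʳ 0ℚ))

coeff-X⊗-suc : ∀ p i → coeff (X ⊗ p) (suc i) ≡ coeff p i
coeff-X⊗-suc p i = begin
  coeff (X ⊗ p) (suc i)                               ≡⟨ coeff-⊕ (scale 0ℚ p) _ (suc i) ⟩
  coeff (scale 0ℚ p) (suc i) + coeff (scale 1ℚ p ⊕ (0ℚ ∷ [])) i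
    ≡⟨ cong₂ _+_ (coeff-0* p (suc i)) (coeff-⊕ (scale 1ℚ p) (0ℚ ∷ []) i) ⟩
  0ℚ + (coeff (scale 1ℚ p) i + coeff (0ℚ ∷ []) i)     ≡⟨ ℚP.+-identityˡ _ ⟩
  coeff (scale 1ℚ p) i + coeff (0ℚ ∷ []) i            ≡⟨ cong₂ _+_ (coeff-scale 1ℚ p i) (coeff-0∷[] i) ⟩
  1ℚ * coeff p i + 0ℚ                                 ≡⟨ ℚP.+-identityʳ _ ⟩
  1ℚ * coeff p i                                      ≡⟨ ℚP.*-identityˡ (coeff p i) ⟩
  coeff p i                                           ∎
  where open ≡-Reasoning

-- coeff₂ P a b is the coefficient of tᵃ qᵇ.
coeff₂ : Poly₂ → ℕ → ℕ → ℚ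
coeff₂ []      a       b = 0ℚ
coeff₂ (r ∷ P) zero    b = coeff r b
coeff₂ (r ∷ P) (suc a) b = coeff₂ P a b

coeff₂-⊕₂ : ∀ P Q a b → coeff₂ (P ⊕₂ Q) a b ≡ coeff₂ P a b + coeff₂ Q a b
coeff₂-⊕₂ []      Q       a       b = sym (ℚP.+-identityˡ _)
coeff₂-⊕₂ (r ∷ P) []      a       b = sym (ℚP.+-identityʳ _)
coeff₂-⊕₂ (r ∷ P) (s ∷ Q) zero    b = coeff-⊕ r s b
coeff₂-⊕₂ (r ∷ P) (s ∷ Q) (suc a) b = coeff₂-⊕₂ P Q a b

coeff₂-shiftT-< : ∀ m P {a} b → a < m → coeff₂ (shiftT m P) a b ≡ 0ℚ
coeff₂-shiftT-< (suc m) P {zero}  b _           = refl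
coeff₂-shiftT-< (suc m) P {suc a} b (s≤s a<m)   = coeff₂-shiftT-< m P b a<m

coeff₂-shiftT : ∀ m P a b → coeff₂ (shiftT m P) (m ℕ.+ a) b ≡ coeff₂ P a b
coeff₂-shiftT zero    P a b = refl
coeff₂-shiftT (suc m) P a b = coeff₂-shiftT m P a b

coeff₂-antiderivFrom : ∀ e P a b →
                       coeff₂ (antiderivFrom e P) a b ≡ inv (ℕ→ℚ (suc (e ℕ.+ a))) * coeff₂ P a b
coeff₂-antiderivFrom e []      a       b = sym (ℚP.*-zeroʳ (inv (ℕ→ℚ (suc (e ℕ.+ a)))))
coeff₂-antiderivFrom e (r ∷ P) zero    b rewrite ℕP.+-identityʳ e =
  trans (coeff-scale (ℤ.1ℤ ℚ./ suc e) r b) (cong (_* coeff r b) (1/suc≡inv e))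
coeff₂-antiderivFrom e (r ∷ P) (suc a) b rewrite ℕP.+-suc e a = coeff₂-antiderivFrom (suc e) P a b

coeff₂-antideriv : ∀ P a b → coeff₂ (antideriv P) (suc a) b ≡ inv (ℕ→ℚ (suc a)) * coeff₂ P a b
coeff₂-antideriv = coeff₂-antiderivFrom 0

coeff-evalAtQ : ∀ P b → coeff (evalAtQ P) b ≡ ∑ (suc b) (λ c → coeff₂ P (b ∸ c) c)
coeff-evalAtQ []      b       = sym (∑-≡0 (suc b) (λ _ → refl))
coeff-evalAtQ (r ∷ P) zero    = begin
  coeff (r ⊕ (X ⊗ evalAtQ P)) 0         ≡⟨ coeff-⊕ r (X ⊗ evalAtQ P) 0 ⟩
  coeff r 0 + coeff (X ⊗ evalAtQ P) 0   ≡⟨ cong (coeff r 0 +_) (coeff-X⊗-zero (evalAtQ P)) ⟩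
  coeff r 0 + 0ℚ                        ≡⟨ ℚP.+-comm (coeff r 0) 0ℚ ⟩
  0ℚ + coeff r 0                        ∎
  where open ≡-Reasoning
coeff-evalAtQ (r ∷ P) (suc b) = begin
  coeff (r ⊕ (X ⊗ evalAtQ P)) (suc b)
    ≡⟨ coeff-⊕ r (X ⊗ evalAtQ P) (suc b) ⟩
  coeff r (suc b) + coeff (X ⊗ evalAtQ P) (suc b)
    ≡⟨ cong (coeff r (suc b) +_) (trans (coeff-X⊗-suc (evalAtQ P) b) (coeff-evalAtQ P b)) ⟩
  coeff r (suc b) + ∑ (suc b) (λ c → coeff₂ P (b ∸ c) c)
    ≡⟨ ℚP.+-comm (coeff r (suc b)) _ ⟩
  ∑ (suc b) (λ c → coeff₂ P (b ∸ c) c) + coeff r (suc b)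
    ≡⟨ cong₂ _+_ (∑-cong (suc b) λ {c} c<1+b →
                    cong (λ a → coeff₂ (r ∷ P) a c) (sym (ℕP.+-∸-assoc 1 (ℕP.≤-pred c<1+b))))
                 (cong (λ a → coeff₂ (r ∷ P) a (suc b)) (sym (ℕP.n∸n≡0 b))) ⟩
  ∑ (suc (suc b)) (λ c → coeff₂ (r ∷ P) (suc b ∸ c) c) ∎
  where open ≡-Reasoning

coeff-evalAt1 : ∀ P {t b} → (∀ {a} → a ≢ t → coeff₂ P a b ≡ 0ℚ) →
                coeff (evalAt1 P) b ≡ coeff₂ P t b
coeff-evalAt1 []      {t}     {b} _      = refl
coeff-evalAt1 (r ∷ P) {zero}  {b} others = begin
  coeff (r ⊕ evalAt1 P) b          ≡⟨ coeff-⊕ r (evalAt1 P) b ⟩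
  coeff r b + coeff (evalAt1 P) b  ≡⟨ cong (coeff r b +_) (coeff-evalAt1 P λ {a} _ → others {suc a} λ ()) ⟩
  coeff r b + coeff₂ P 0 b         ≡⟨ cong (coeff r b +_) (others {1} λ ()) ⟩
  coeff r b + 0ℚ                   ≡⟨ ℚP.+-identityʳ (coeff r b) ⟩
  coeff r b                        ∎
  where open ≡-Reasoning
coeff-evalAt1 (r ∷ P) {suc t} {b} others = begin
  coeff (r ⊕ evalAt1 P) b          ≡⟨ coeff-⊕ r (evalAt1 P) b ⟩
  coeff r b + coeff (evalAt1 P) b
    ≡⟨ cong₂ _+_ (others {0} λ ()) (coeff-evalAt1 P (others ∘ (_∘ ℕP.suc-injective))) ⟩
  0ℚ + coeff₂ P t b                ≡⟨ ℚP.+-identityˡ _ ⟩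
  coeff₂ P t b                     ∎
  where open ≡-Reasoning

-- Homogeneous bivariate polynomials: P (t , q) = Σ_{b ≤ d} H b · qᵇ · t^(d ∸ b)

record Homogeneous (P : Poly₂) (d : ℕ) (H : ℕ → ℚ) : Set where
  field
    on-degree  : ∀ {a b} → a ℕ.+ b ≡ d → coeff₂ P a b ≡ H b
    off-degree : ∀ {a b} → a ℕ.+ b ≢ d → coeff₂ P a b ≡ 0ℚ
    above      : ∀ {b} → d < b → H b ≡ 0ℚ

Homogeneous-cong : ∀ {P d H H′} → (∀ b → H b ≡ H′ b) → Homogeneous P d H → Homogeneous P d H′
Homogeneous-cong H≗H′ hom = record
  { on-degree  = λ a+b≡d → trans (on-degree a+b≡d) (H≗H′ _)
  ; off-degree = off-degree
  ; above      = λ d<b → trans (sym (H≗H′ _)) (above d<b)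
  }
  where open Homogeneous hom

coeff-evalAt1-homogeneous : ∀ {P d H} → Homogeneous P d H → ∀ b → coeff (evalAt1 P) b ≡ H b
coeff-evalAt1-homogeneous {P} {d} hom b with b ≤? d
... | yes b≤d = trans (coeff-evalAt1 P λ {a} a≢d∸b → off-degree λ a+b≡d →
                         a≢d∸b (trans (sym (ℕP.m+n∸n≡m a b)) (cong (_∸ b) a+b≡d)))
                      (on-degree (ℕP.m∸n+n≡m b≤d))
  where open Homogeneous hom
... | no b≰d = trans (coeff-evalAt1 P {t = 0} λ _ → off-degree b≰deg)
                     (trans (off-degree b≰deg) (sym (above (ℕP.≰⇒> b≰d))))
  where
  open Homogeneous hom
  b≰deg : ∀ {a} → a ℕ.+ b ≢ d
  b≰deg {a} a+b≡d = b≰d (subst (b ≤_) a+b≡d (ℕP.m≤n+m b a))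

Homogeneous-cast : ∀ {P P′ d d′ H H′} → P ≡ P′ → d ≡ d′ → (∀ b → H b ≡ H′ b) →
                   Homogeneous P d H → Homogeneous P′ d′ H′
Homogeneous-cast refl refl = Homogeneous-cong

homogeneous-shiftT : ∀ m {P d H} → Homogeneous P d H → Homogeneous (shiftT m P) (d ℕ.+ m) H
homogeneous-shiftT m {P} {d} {H} hom = record
  { on-degree  = on
  ; off-degree = off
  ; above      = λ d+m<b → above (ℕP.≤-<-trans (ℕP.m≤m+n d m) d+m<b)
  }
  where
  open Homogeneous hom
  unshift : ∀ {a b} → m ≤ a → a ℕ.+ b ≡ d ℕ.+ m → (a ∸ m) ℕ.+ b ≡ d
  unshift {a} {b} m≤a eq = trans (sym (ℕP.+-∸-comm b m≤a)) (trans (cong (_∸ m) eq) (ℕP.m+n∸n≡m d m))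
  shifted : ∀ {a b} → m ≤ a → coeff₂ (shiftT m P) a b ≡ coeff₂ P (a ∸ m) b
  shifted {a} {b} m≤a = trans (cong (λ a → coeff₂ (shiftT m P) a b) (sym (ℕP.m+[n∸m]≡n m≤a)))
                              (coeff₂-shiftT m P (a ∸ m) b)
  on : ∀ {a b} → a ℕ.+ b ≡ d ℕ.+ m → coeff₂ (shiftT m P) a b ≡ H b
  on {a} {b} eq with m ≤? a
  ... | yes m≤a = trans (shifted m≤a) (on-degree (unshift m≤a eq))
  ... | no  m≰a = trans (coeff₂-shiftT-< m P b a<m) (sym (above (ℕP.≰⇒> b≰d)))
    where
    a<m = ℕP.≰⇒> m≰a
    b≰d : b ≰ d
    b≰d b≤d = ℕP.<-irrefl (trans eq (ℕP.+-comm d m)) (ℕP.+-mono-<-≤ a<m b≤d)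
  off : ∀ {a b} → a ℕ.+ b ≢ d ℕ.+ m → coeff₂ (shiftT m P) a b ≡ 0ℚ
  off {a} {b} ne with m ≤? a
  ... | yes m≤a = trans (shifted m≤a) (off-degree λ eq → ne (begin
    a ℕ.+ b                    ≡⟨ ℕP.m∸n+n≡m (ℕP.≤-trans m≤a (ℕP.m≤m+n a b)) ⟨
    a ℕ.+ b ∸ m ℕ.+ m          ≡⟨ cong (ℕ._+ m) (trans (ℕP.+-∸-comm b m≤a) eq) ⟩
    d ℕ.+ m                    ∎))
    where open ≡-Reasoning
  ... | no  m≰a = coeff₂-shiftT-< m P b (ℕP.≰⇒> m≰a)

module _ {S e H} (hom : Homogeneous S e H) where
  open Homogeneous hom

  private
    A : Poly₂
    A = antideriv S

    A-on : ∀ {a b} → a ℕ.+ b ≡ e → coeff₂ A (suc a) b ≡ inv (ℕ→ℚ (suc a)) * H b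
    A-on {a} {b} eq = trans (coeff₂-antideriv S a b) (cong (inv (ℕ→ℚ (suc a)) *_) (on-degree eq))

    A-off : ∀ {a b} → a ℕ.+ b ≢ suc e → coeff₂ A a b ≡ 0ℚ
    A-off {zero}      ne = refl
    A-off {suc a} {b} ne = trans (coeff₂-antideriv S a b)
      (trans (cong (inv (ℕ→ℚ (suc a)) *_) (off-degree {a} {b} (ne ∘ cong suc)))
             (ℚP.*-zeroʳ (inv (ℕ→ℚ (suc a)))))

    coeff-A[q]-off : ∀ {b} → b ≢ suc e → coeff (evalAtQ A) b ≡ 0ℚ
    coeff-A[q]-off {b} ne = trans (coeff-evalAtQ A b) (∑-≡0 (suc b) λ {c} c<1+b →
      A-off {b ∸ c} {c} (ne ∘ trans (sym (ℕP.m∸n+n≡m (ℕP.≤-pred c<1+b)))))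

    coeff₂-integrateFromQ-zero : ∀ b → coeff₂ (integrateFromQ S) 0 b ≡ - coeff (evalAtQ A) b
    coeff₂-integrateFromQ-zero b =
      trans (coeff₂-⊕₂ A ((⊖ evalAtQ A) ∷ []) 0 b) (trans (ℚP.+-identityˡ _) (coeff-⊖ (evalAtQ A) b))

    coeff₂-integrateFromQ-suc : ∀ a b → coeff₂ (integrateFromQ S) (suc a) b ≡ coeff₂ A (suc a) b
    coeff₂-integrateFromQ-suc a b =
      trans (coeff₂-⊕₂ A ((⊖ evalAtQ A) ∷ []) (suc a) b) (ℚP.+-identityʳ _)

  -- The lower limit q contributes only to the t-free part, which is fixed by the vanishing at t = q.
  homogeneous-integrateFromQ : (H′ : ℕ → ℚ) →
    (∀ {b} → b ≤ e → H′ b ≡ inv (ℕ→ℚ (suc e ∸ b)) * H b) →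
    ∑ (suc (suc e)) H′ ≡ 0ℚ →
    (∀ {b} → suc e < b → H′ b ≡ 0ℚ) →
    Homogeneous (integrateFromQ S) (suc e) H′
  homogeneous-integrateFromQ H′ below total above′ =
    record { on-degree = λ {a} {b} → on {a} {b} ; off-degree = λ {a} {b} → off {a} {b} ; above = above′ }
    where
    open ≡-Reasoning
    coeff-A[q]-top : coeff (evalAtQ A) (suc e) ≡ ∑ (suc e) H′
    coeff-A[q]-top = begin
      coeff (evalAtQ A) (suc e)                                                 ≡⟨ coeff-evalAtQ A (suc e) ⟩
      ∑ (suc e) (λ c → coeff₂ A (suc e ∸ c) c) + coeff₂ A (suc e ∸ suc e) (suc e)
        ≡⟨ cong₂ _+_ (∑-cong (suc e) term) (cong (λ a → coeff₂ A a (suc e)) (ℕP.n∸n≡0 e)) ⟩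
      ∑ (suc e) H′ + 0ℚ                                                         ≡⟨ ℚP.+-identityʳ _ ⟩
      ∑ (suc e) H′                                                              ∎
      where
      term : ∀ {c} → c < suc e → coeff₂ A (suc e ∸ c) c ≡ H′ c
      term {c} c<1+e = begin
        coeff₂ A (suc e ∸ c) c           ≡⟨ cong (λ a → coeff₂ A a c) (ℕP.+-∸-assoc 1 c≤e) ⟩
        coeff₂ A (suc (e ∸ c)) c         ≡⟨ A-on (ℕP.m∸n+n≡m c≤e) ⟩
        inv (ℕ→ℚ (suc (e ∸ c))) * H c    ≡⟨ cong (λ a → inv (ℕ→ℚ a) * H c) (ℕP.+-∸-assoc 1 c≤e) ⟨
        inv (ℕ→ℚ (suc e ∸ c)) * H c      ≡⟨ below c≤e ⟨
        H′ c                             ∎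
        where c≤e = ℕP.≤-pred c<1+e
    on : ∀ {a b} → a ℕ.+ b ≡ suc e → coeff₂ (integrateFromQ S) a b ≡ H′ b
    on {zero} refl = begin
      coeff₂ (integrateFromQ S) 0 (suc e)   ≡⟨ coeff₂-integrateFromQ-zero (suc e) ⟩
      - coeff (evalAtQ A) (suc e)           ≡⟨ cong -_ coeff-A[q]-top ⟩
      - ∑ (suc e) H′                        ≡⟨ +-inverseʳ-unique (∑ (suc e) H′) (H′ (suc e)) total ⟨
      H′ (suc e)                            ∎
    on {suc a} {b} eq = begin
      coeff₂ (integrateFromQ S) (suc a) b   ≡⟨ coeff₂-integrateFromQ-suc a b ⟩
      coeff₂ A (suc a) b                    ≡⟨ A-on (ℕP.suc-injective eq) ⟩
      inv (ℕ→ℚ (suc a)) * H b               ≡⟨ cong (λ n → inv (ℕ→ℚ n) * H b) D∸b≡1+a ⟨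
      inv (ℕ→ℚ (suc e ∸ b)) * H b           ≡⟨ below b≤e ⟨
      H′ b                                  ∎
      where
      b≤e : b ≤ e
      b≤e = ℕP.≤-pred (subst (b <_) eq (ℕP.m<n+m b (s≤s z≤n)))
      D∸b≡1+a : suc e ∸ b ≡ suc a
      D∸b≡1+a = trans (cong (_∸ b) (sym eq)) (ℕP.m+n∸n≡m (suc a) b)
    off : ∀ {a b} → a ℕ.+ b ≢ suc e → coeff₂ (integrateFromQ S) a b ≡ 0ℚ
    off {zero}  {b} ne = trans (coeff₂-integrateFromQ-zero b) (cong -_ (coeff-A[q]-off ne))
    off {suc a} {b} ne = trans (coeff₂-integrateFromQ-suc a b) (A-off {suc a} {b} ne)

one₂ : Poly₂
one₂ = (1ℚ ∷ []) ∷ []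

length-∷ʳ : ∀ (c : List ℕ) x → length (c ∷ʳ x) ≡ suc (length c)
length-∷ʳ []      x = refl
length-∷ʳ (y ∷ c) x = cong suc (length-∷ʳ c x)

sum-∷ʳ : ∀ c x → sum (c ∷ʳ x) ≡ sum c ℕ.+ x
sum-∷ʳ []      x = ℕP.+-identityʳ x
sum-∷ʳ (y ∷ c) x = trans (cong (y ℕ.+_) (sum-∷ʳ c x)) (sym (ℕP.+-assoc y (sum c) x))

β-length : ∀ c → β c (length c) ≡ sum c
β-length []      = refl
β-length (x ∷ c) = cong (x ℕ.+_) (β-length c)

β-∷ʳ : ∀ c x {j} → j ≤ length c → β (c ∷ʳ x) j ≡ β c j
β-∷ʳ c       x {zero}  _         = refl
β-∷ʳ (y ∷ c) x {suc j} (s≤s j≤k) = cong (y ℕ.+_) (β-∷ʳ c x j≤k)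

β-ascending : ∀ {c} → All (1 ≤_) c → Ascending (β c) (length c)
β-ascending {x ∷ c} (1≤x ∷ pos) {zero}  _         = ℕP.≤-trans 1≤x (ℕP.m≤m+n x 0)
β-ascending {x ∷ c} (1≤x ∷ pos) {suc l} (s≤s l<k) = ℕP.+-monoʳ-< x (β-ascending pos l<k)

length≤sum : ∀ {c} → All (1 ≤_) c → length c ≤ sum c
length≤sum []          = z≤n
length≤sum (1≤x ∷ pos) = ℕP.+-mono-≤ 1≤x (length≤sum pos)

innerIntegrals-∷ʳ : ∀ h c x →
                    innerIntegrals h (c ∷ʳ x) ≡ integrateFromQ (shiftT (x ∸ 1) (innerIntegrals h c))
innerIntegrals-∷ʳ h []      x = refl
innerIntegrals-∷ʳ h (y ∷ c) x = innerIntegrals-∷ʳ _ c x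

homogeneous-[] : Homogeneous one₂ 0 (nodeCoeff (β []) 0)
homogeneous-[] = record
  { on-degree = λ {a} {b} → on {a} {b} ; off-degree = λ {a} {b} → off {a} {b} ; above = above }
  where
  on : ∀ {a b} → a ℕ.+ b ≡ 0 → coeff₂ one₂ a b ≡ nodeCoeff (β []) 0 b
  on {zero} {zero} _ = refl
  off : ∀ {a b} → a ℕ.+ b ≢ 0 → coeff₂ one₂ a b ≡ 0ℚ
  off {zero}  {zero}  ne = contradiction refl ne
  off {zero}  {suc b} _  = refl
  off {suc a}         _  = refl
  above : ∀ {b} → 0 < b → nodeCoeff (β []) 0 b ≡ 0ℚ
  above {suc b} _ = refl

homogeneous-∷ʳ : ∀ c m → All (1 ≤_) (c ∷ʳ suc m) →
  Homogeneous (innerIntegrals one₂ c) (sum c) (nodeCoeff (β c) (length c)) →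
  Homogeneous (integrateFromQ (shiftT m (innerIntegrals one₂ c))) (suc (sum c ℕ.+ m))
              (nodeCoeff (β (c ∷ʳ suc m)) (suc (length c)))
homogeneous-∷ʳ c m pos hom =
  homogeneous-integrateFromQ (homogeneous-shiftT m hom′) (nodeCoeff B (suc k)) below total above
  where
  k = length c
  e = sum c ℕ.+ m
  B = β (c ∷ʳ suc m)
  asc : Ascending B (suc k)
  asc = subst (Ascending B) (length-∷ʳ c (suc m)) (β-ascending pos)
  top : B (suc k) ≡ suc e
  top = begin
    B (suc k)                ≡⟨ cong B (length-∷ʳ c (suc m)) ⟨
    B (length (c ∷ʳ suc m))  ≡⟨ β-length (c ∷ʳ suc m) ⟩
    sum (c ∷ʳ suc m)         ≡⟨ sum-∷ʳ c (suc m) ⟩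
    sum c ℕ.+ suc m          ≡⟨ ℕP.+-suc (sum c) m ⟩
    suc e                    ∎
    where open ≡-Reasoning
  hom′ : Homogeneous (innerIntegrals one₂ c) (sum c) (nodeCoeff B k)
  hom′ = Homogeneous-cong (λ b → nodeCoeff-cong k b λ l<1+k → sym (β-∷ʳ c (suc m) (ℕP.≤-pred l<1+k)))
                          hom
  below : ∀ {b} → b ≤ e → nodeCoeff B (suc k) b ≡ inv (ℕ→ℚ (suc e ∸ b)) * nodeCoeff B k b
  below {b} b≤e = subst (λ D → nodeCoeff B (suc k) b ≡ inv (ℕ→ℚ (D ∸ b)) * nodeCoeff B k b) top
                        (nodeCoeff-suc B k (subst (b <_) (sym top) (s≤s b≤e)))
  total : ∑ (suc (suc e)) (nodeCoeff B (suc k)) ≡ 0ℚ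
  total = subst (λ D → ∑ (suc D) (nodeCoeff B (suc k)) ≡ 0ℚ) top
                (trans (∑-nodeCoeff asc) (∑-lagrangeWeight (ℕ→ℚ ∘ B) k (ascending⇒distinct asc)))
  above : ∀ {b} → suc e < b → nodeCoeff B (suc k) b ≡ 0ℚ
  above {b} 1+e<b = nodeCoeff-above asc (subst (_< b) (sym top) 1+e<b)

innerIntegrals-homogeneous : ∀ c → All (1 ≤_) c →
                             Homogeneous (innerIntegrals one₂ c) (sum c) (nodeCoeff (β c) (length c))
innerIntegrals-homogeneous c = go (reverseView c)
  where
  go : ∀ {c} → Reverse c → All (1 ≤_) c →
       Homogeneous (innerIntegrals one₂ c) (sum c) (nodeCoeff (β c) (length c))
  go []              _   = homogeneous-[]
  go (c ∶ rc ∶ʳ zero)  pos = contradiction (proj₂ (AllP.∷ʳ⁻ pos)) λ ()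
  go (c ∶ rc ∶ʳ suc m) pos =
    Homogeneous-cast (sym (innerIntegrals-∷ʳ one₂ c (suc m)))
                     (sym (trans (sum-∷ʳ c (suc m)) (ℕP.+-suc (sum c) m)))
                     (λ b → cong (λ k → nodeCoeff (β (c ∷ʳ suc m)) k b) (sym (length-∷ʳ c (suc m))))
                     (homogeneous-∷ʳ c m pos (go rc (AllP.++⁻ˡ c pos)))

coeff≢0⇒<length : ∀ p {i} → coeff p i ≢ 0ℚ → i < length p
coeff≢0⇒<length []      {i}     ne = contradiction refl ne
coeff≢0⇒<length (a ∷ p) {zero}  ne = s≤s z≤n
coeff≢0⇒<length (a ∷ p) {suc i} ne = s≤s (coeff≢0⇒<length p ne)

coeff-compPoly : ∀ c → All (1 ≤_) c → ∀ b → coeff (compPoly c) b ≡ nodeCoeff (β c) (length c) b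
coeff-compPoly c pos = coeff-evalAt1-homogeneous (innerIntegrals-homogeneous c pos)

sum<length-compPoly : ∀ c → All (1 ≤_) c → sum c < length (compPoly c)
sum<length-compPoly c pos = coeff≢0⇒<length (compPoly c) λ top≡0 →
  lagrangeWeight≢0 (ascending⇒distinct asc) (ℕP.n<1+n k) (begin
    lagrangeWeight (ℕ→ℚ ∘ β c) k k    ≡⟨ nodeCoeff-last asc ⟨
    nodeCoeff (β c) k (β c k)         ≡⟨ cong (nodeCoeff (β c) k) (β-length c) ⟩
    nodeCoeff (β c) k (sum c)         ≡⟨ coeff-compPoly c pos (sum c) ⟨
    coeff (compPoly c) (sum c)        ≡⟨ top≡0 ⟩
    0ℚ                                ∎)
  where
  open ≡-Reasoning
  k = length c
  asc = β-ascending pos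

partialSums^ : ℕ → (ℕ → ℚ) → ℕ → ℚ
partialSums^ zero    f i = f i
partialSums^ (suc k) f i = ∑ (suc i) (partialSums^ k f)

partialSums^-cong : ∀ k {f g} → (∀ m → f m ≡ g m) → ∀ i → partialSums^ k f i ≡ partialSums^ k g i
partialSums^-cong zero    f≗g i = f≗g i
partialSums^-cong (suc k) f≗g i = ∑-cong (suc i) λ {m} _ → partialSums^-cong k f≗g m

partialSums^-linear : ∀ k N (w : ℕ → ℚ) (F : ℕ → ℕ → ℚ) i →
  partialSums^ k (λ m → ∑ N (λ j → w j * F j m)) i ≡ ∑ N (λ j → w j * partialSums^ k (F j) i)
partialSums^-linear zero    N w F i = refl
partialSums^-linear (suc k) N w F i = begin
  ∑ (suc i) (partialSums^ k (λ m → ∑ N (λ j → w j * F j m)))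
    ≡⟨ ∑-cong (suc i) (λ {m} _ → partialSums^-linear k N w F m) ⟩
  ∑ (suc i) (λ m → ∑ N (λ j → w j * partialSums^ k (F j) m))
    ≡⟨ ∑-comm (suc i) N _ ⟩
  ∑ N (λ j → ∑ (suc i) (λ m → w j * partialSums^ k (F j) m))
    ≡⟨ ∑-cong N (λ {j} _ → ∑-distribˡ-* (suc i) (w j) (partialSums^ k (F j))) ⟩
  ∑ N (λ j → w j * partialSums^ (suc k) (F j) i) ∎
  where open ≡-Reasoning

coeff-divOneMinusQFrom : ∀ acc p i → suc i < length p →
                         coeff (divOneMinusQFrom acc p) i ≡ acc + ∑ (suc i) (coeff p)
coeff-divOneMinusQFrom acc (a ∷ [])    zero    (s≤s ())
coeff-divOneMinusQFrom acc (a ∷ b ∷ p) zero    _           = cong (acc +_) (sym (ℚP.+-identityˡ a))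
coeff-divOneMinusQFrom acc (a ∷ b ∷ p) (suc i) (s≤s 2+i<) = begin
  coeff (divOneMinusQFrom (acc + a) (b ∷ p)) i   ≡⟨ coeff-divOneMinusQFrom (acc + a) (b ∷ p) i 2+i< ⟩
  acc + a + ∑ (suc i) (coeff (b ∷ p))            ≡⟨ ℚP.+-assoc acc a _ ⟩
  acc + (a + ∑ (suc i) (coeff (b ∷ p)))          ≡⟨ cong (acc +_) (∑-unfoldˡ (suc i) _) ⟨
  acc + ∑ (suc (suc i)) (coeff (a ∷ b ∷ p))      ∎
  where open ≡-Reasoning

length-divOneMinusQFrom : ∀ acc p → length (divOneMinusQFrom acc p) ≡ length p ∸ 1
length-divOneMinusQFrom acc []          = refl
length-divOneMinusQFrom acc (a ∷ [])    = refl
length-divOneMinusQFrom acc (a ∷ b ∷ p) = cong suc (length-divOneMinusQFrom (acc + a) (b ∷ p))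

length-divOneMinusQ^ : ∀ k p → length (divOneMinusQ^ k p) ≡ length p ∸ k
length-divOneMinusQ^ zero    p = refl
length-divOneMinusQ^ (suc k) p = begin
  length (divOneMinusQ (divOneMinusQ^ k p))  ≡⟨ length-divOneMinusQFrom 0ℚ (divOneMinusQ^ k p) ⟩
  length (divOneMinusQ^ k p) ∸ 1             ≡⟨ cong (_∸ 1) (length-divOneMinusQ^ k p) ⟩
  length p ∸ k ∸ 1                           ≡⟨ ℕP.∸-+-assoc (length p) k 1 ⟩
  length p ∸ (k ℕ.+ 1)                       ≡⟨ cong (length p ∸_) (ℕP.+-comm k 1) ⟩
  length p ∸ suc k                           ∎
  where open ≡-Reasoning

-- Exactness needs i + k < length p: divOneMinusQ drops the last coefficient.
coeff-divOneMinusQ^ : ∀ k p i → i ℕ.+ k < length p →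
                      coeff (divOneMinusQ^ k p) i ≡ partialSums^ k (coeff p) i
coeff-divOneMinusQ^ zero    p i _        = refl
coeff-divOneMinusQ^ (suc k) p i i+1+k<len = begin
  coeff (divOneMinusQFrom 0ℚ (divOneMinusQ^ k p)) i
    ≡⟨ coeff-divOneMinusQFrom 0ℚ (divOneMinusQ^ k p) i 1+i<len′ ⟩
  0ℚ + ∑ (suc i) (coeff (divOneMinusQ^ k p))
    ≡⟨ ℚP.+-identityˡ _ ⟩
  ∑ (suc i) (coeff (divOneMinusQ^ k p))
    ≡⟨ ∑-cong (suc i) (λ m<1+i → coeff-divOneMinusQ^ k p _ (m+k<len m<1+i)) ⟩
  ∑ (suc i) (partialSums^ k (coeff p))                ∎
  where
  open ≡-Reasoning
  2+i+k≤len : suc (suc i) ℕ.+ k ≤ length p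
  2+i+k≤len = subst (_≤ length p) (cong suc (ℕP.+-suc i k)) i+1+k<len
  1+i<len′ : suc i < length (divOneMinusQ^ k p)
  1+i<len′ = subst (suc i <_) (sym (length-divOneMinusQ^ k p)) (ℕP.m+n≤o⇒m≤o∸n (suc (suc i)) 2+i+k≤len)
  m+k<len : ∀ {m} → m < suc i → m ℕ.+ k < length p
  m+k<len m<1+i = ℕP.<-≤-trans (ℕP.+-monoˡ-< k m<1+i) (ℕP.≤-trans (ℕP.n≤1+n _) 2+i+k≤len)

-- shiftedMultichoose k s i is the coefficient of qⁱ in qˢ / (1 - q)ᵏ.
shiftedMultichoose : ℕ → ℕ → ℕ → ℚ
shiftedMultichoose k s i = if does (s ≤? i) then ℕ→ℚ (multichoose k (i ∸ s)) else 0ℚ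

shiftedMultichoose-≤ : ∀ k {s i} → s ≤ i → shiftedMultichoose k s i ≡ ℕ→ℚ (multichoose k (i ∸ s))
shiftedMultichoose-≤ k {s} {i} s≤i =
  cong (λ b → if b then ℕ→ℚ (multichoose k (i ∸ s)) else 0ℚ) (dec-true (s ≤? i) s≤i)

shiftedMultichoose-> : ∀ k {s i} → s ≰ i → shiftedMultichoose k s i ≡ 0ℚ
shiftedMultichoose-> k {s} {i} s≰i =
  cong (λ b → if b then ℕ→ℚ (multichoose k (i ∸ s)) else 0ℚ) (dec-false (s ≤? i) s≰i)

multichoose-pascal : ∀ k r → multichoose (suc k) r ℕ.+ multichoose k (suc r) ≡ multichoose (suc k) (suc r)
multichoose-pascal k r rewrite ℕP.+-suc k r = nCk+nC[k+1]≡[n+1]C[k+1] (k ℕ.+ r) r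

δ≡shiftedMultichoose : ∀ s i → δ s i ≡ shiftedMultichoose 0 s i
δ≡shiftedMultichoose s i with s ≤? i
... | no s≰i = trans (δ-≢ (s≰i ∘ ℕP.≤-reflexive)) (sym (shiftedMultichoose-> 0 s≰i))
... | yes s≤i with s ℕ.≟ i
...   | yes refl = trans (δ-≡ s) (sym (trans (shiftedMultichoose-≤ 0 s≤i)
                                             (cong (ℕ→ℚ ∘ multichoose 0) (ℕP.n∸n≡0 s))))
...   | no s≢i   =
  trans (δ-≢ s≢i) (sym (trans (shiftedMultichoose-≤ 0 s≤i) (cong ℕ→ℚ 0C[i∸s]≡0)))
  where
  0C[i∸s]≡0 : multichoose 0 (i ∸ s) ≡ 0
  0C[i∸s]≡0 with i ∸ s | ℕP.m<n⇒0<n∸m (ℕP.≤∧≢⇒< s≤i s≢i)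
  ... | suc r | _ = k>n⇒nCk≡0 (ℕP.n<1+n r)

∑-shiftedMultichoose : ∀ k s i → ∑ (suc i) (shiftedMultichoose k s) ≡ shiftedMultichoose (suc k) s i
∑-shiftedMultichoose k s zero with s ≤? 0
... | yes z≤n = ℚP.+-identityˡ _
... | no  s≰0 =
  trans (ℚP.+-identityˡ _) (trans (shiftedMultichoose-> k s≰0) (sym (shiftedMultichoose-> (suc k) s≰0)))
∑-shiftedMultichoose k s (suc i) =
  trans (cong (_+ shiftedMultichoose k s (suc i)) (∑-shiftedMultichoose k s i)) (step (s ≤? i) (s ≤? suc i))
  where
  step : Dec (s ≤ i) → Dec (s ≤ suc i) →
         shiftedMultichoose (suc k) s i + shiftedMultichoose k s (suc i) ≡ shiftedMultichoose (suc k) s (suc i)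
  step (yes s≤i) _ = begin
    shiftedMultichoose (suc k) s i + shiftedMultichoose k s (suc i)
      ≡⟨ cong₂ _+_ (shiftedMultichoose-≤ (suc k) s≤i) (shiftedMultichoose-≤ k s≤1+i) ⟩
    ℕ→ℚ (multichoose (suc k) (i ∸ s)) + ℕ→ℚ (multichoose k (suc i ∸ s))
      ≡⟨ cong (λ r → ℕ→ℚ (multichoose (suc k) (i ∸ s)) + ℕ→ℚ (multichoose k r)) 1+i∸s ⟩
    ℕ→ℚ (multichoose (suc k) (i ∸ s)) + ℕ→ℚ (multichoose k (suc (i ∸ s)))
      ≡⟨ ℕ→ℚ-homo-+ (multichoose (suc k) (i ∸ s)) (multichoose k (suc (i ∸ s))) ⟨
    ℕ→ℚ (multichoose (suc k) (i ∸ s) ℕ.+ multichoose k (suc (i ∸ s)))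
      ≡⟨ cong ℕ→ℚ (multichoose-pascal k (i ∸ s)) ⟩
    ℕ→ℚ (multichoose (suc k) (suc (i ∸ s)))
      ≡⟨ cong (ℕ→ℚ ∘ multichoose (suc k)) 1+i∸s ⟨
    ℕ→ℚ (multichoose (suc k) (suc i ∸ s))
      ≡⟨ shiftedMultichoose-≤ (suc k) s≤1+i ⟨
    shiftedMultichoose (suc k) s (suc i) ∎
    where
    open ≡-Reasoning
    s≤1+i = ℕP.m≤n⇒m≤1+n s≤i
    1+i∸s = ℕP.+-∸-assoc 1 s≤i
  step (no s≰i) (yes s≤1+i) = begin
    shiftedMultichoose (suc k) s i + shiftedMultichoose k s (suc i)
      ≡⟨ cong₂ _+_ (shiftedMultichoose-> (suc k) s≰i) (shiftedMultichoose-≤ k s≤1+i) ⟩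
    0ℚ + ℕ→ℚ (multichoose k (suc i ∸ s))
      ≡⟨ ℚP.+-identityˡ _ ⟩
    ℕ→ℚ (multichoose k (suc i ∸ s))
      ≡⟨ cong (λ r → ℕ→ℚ (multichoose k r)) 1+i∸s≡0 ⟩
    1ℚ
      ≡⟨ cong (λ r → ℕ→ℚ (multichoose (suc k) r)) 1+i∸s≡0 ⟨
    ℕ→ℚ (multichoose (suc k) (suc i ∸ s))
      ≡⟨ shiftedMultichoose-≤ (suc k) s≤1+i ⟨
    shiftedMultichoose (suc k) s (suc i) ∎
    where
    open ≡-Reasoning
    1+i∸s≡0 : suc i ∸ s ≡ 0
    1+i∸s≡0 = ℕP.m≤n⇒m∸n≡0 (ℕP.≰⇒> s≰i)
  step (no s≰i) (no s≰1+i) = begin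
    shiftedMultichoose (suc k) s i + shiftedMultichoose k s (suc i)
      ≡⟨ cong₂ _+_ (shiftedMultichoose-> (suc k) s≰i) (shiftedMultichoose-> k s≰1+i) ⟩
    0ℚ + 0ℚ
      ≡⟨ shiftedMultichoose-> (suc k) s≰1+i ⟨
    shiftedMultichoose (suc k) s (suc i) ∎
    where open ≡-Reasoning

partialSums^-δ : ∀ k s i → partialSums^ k (δ s) i ≡ shiftedMultichoose k s i
partialSums^-δ zero    s i = δ≡shiftedMultichoose s i
partialSums^-δ (suc k) s i =
  trans (∑-cong (suc i) λ {m} _ → partialSums^-δ k s m) (∑-shiftedMultichoose k s i)

partialSums^-nodeCoeff : ∀ r B k i → partialSums^ r (nodeCoeff B k) i ≡
  ∑ (suc k) (λ j → lagrangeWeight (ℕ→ℚ ∘ B) k j * shiftedMultichoose r (B j) i)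
partialSums^-nodeCoeff r B k i = trans (partialSums^-linear r (suc k) w (δ ∘ B) i)
                                       (∑-cong (suc k) λ {j} _ → cong (w j *_) (partialSums^-δ r (B j) i))
  where w = lagrangeWeight (ℕ→ℚ ∘ B) k

if-then-*ʳ : ∀ b p q → (if b then p * q else 0ℚ) ≡ p * (if b then q else 0ℚ)
if-then-*ʳ true  p q = refl
if-then-*ʳ false p q = sym (ℚP.*-zeroʳ p)

denom≡∏-except : ∀ c j →
                 denom c j ≡ ∏-except (suc (length c)) j (λ l → ℕ→ℚ (β c l) - ℕ→ℚ (β c j))
denom≡∏-except c j = trans (prodℚ-map-filter (λ l → ¬? (l ℕ.≟ j)) _ (upTo (suc (length c))))
                           (prodℚ-map-upTo (suc (length c)) _)

formula≡∑ : ∀ c i → let k = length c in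
  formula c i ≡ ∑ (suc k) (λ j → lagrangeWeight (ℕ→ℚ ∘ β c) k j * shiftedMultichoose k (β c j) i)
formula≡∑ c i = begin
  formula c i
    ≡⟨ sumℚ-map-filter (λ j → β c j ≤? i) F (upTo (suc k)) ⟩
  sumℚ (map (λ j → if does (β c j ≤? i) then F j else 0ℚ) (upTo (suc k)))
    ≡⟨ sumℚ-map-upTo (suc k) _ ⟩
  ∑ (suc k) (λ j → if does (β c j ≤? i) then F j else 0ℚ)
    ≡⟨ ∑-cong (suc k) (λ {j} _ → summand j) ⟩
  ∑ (suc k) (λ j → lagrangeWeight (ℕ→ℚ ∘ β c) k j * shiftedMultichoose k (β c j) i) ∎
  where
  open ≡-Reasoning
  k = length c
  F : ℕ → ℚ
  F j = inv (denom c j) * ℕ→ℚ (multichoose k (i ∸ β c j))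
  summand : ∀ j → (if does (β c j ≤? i) then F j else 0ℚ) ≡
                  lagrangeWeight (ℕ→ℚ ∘ β c) k j * shiftedMultichoose k (β c j) i
  summand j = trans (if-then-*ʳ (does (β c j ≤? i)) (inv (denom c j)) (ℕ→ℚ (multichoose k (i ∸ β c j))))
                    (cong (λ d → inv d * shiftedMultichoose k (β c j) i) (denom≡∏-except c j))

corollary7p6 : (n : ℕ) (c : List ℕ) → All (λ x → 1 ≤ x) c → sum c ≡ n →
               (i : ℕ) → i ≤ n ∸ length c →
               coeff (redCompPoly c) i ≡ formula c i
corollary7p6 n c pos refl i i≤n∸k = begin
  coeff (redCompPoly c) i                                   ≡⟨ coeff-divOneMinusQ^ k (compPoly c) i i+k<length ⟩
  partialSums^ k (coeff (compPoly c)) i                     ≡⟨ partialSums^-cong k (coeff-compPoly c pos) i ⟩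
  partialSums^ k (nodeCoeff (β c) k) i                      ≡⟨ partialSums^-nodeCoeff k (β c) k i ⟩
  ∑ (suc k) (λ j → w j * shiftedMultichoose k (β c j) i)     ≡⟨ formula≡∑ c i ⟨
  formula c i                                               ∎
  where
  open ≡-Reasoning
  k = length c
  w = lagrangeWeight (ℕ→ℚ ∘ β c) k
  i+k≤n : i ℕ.+ k ≤ sum c
  i+k≤n = subst (i ℕ.+ k ≤_) (ℕP.m∸n+n≡m (length≤sum pos)) (ℕP.+-monoˡ-≤ k i≤n∸k)
  i+k<length : i ℕ.+ k < length (compPoly c)
  i+k<length = ℕP.≤-<-trans i+k≤n (sum<length-compPoly c pos)
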